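{- There is a rectangular reduction of length $O(n)$ from $PIP_2$ to $L_5$: there exist $t=O(n)$ and functions $\alpha_1,\alpha_3,\dots,\alpha_{2t-1}$ and $\beta_2,\beta_4,\dots,\beta_{2t}$ from $\{0,1\}^n$ to $\{a,b,\epsilon\}$ such that for every $(x,y)$ in the domain $D$ of $PIP_2$, $PIP_2(x,y)=1$ if and only if the word $\alpha_1(x)\beta_2(y)\alpha_3(x)\beta_4(y)\cdots\alpha_{2t-1}(x)\beta_{2t}(y)$ belongs to $L_5$.
   Context: $L_5\subseteq\{a,b\}^*$ is recognized by the deterministic automaton with states $1,\dots,5$, initial state $1$, accepting set $\{5\}$, and transitions $1\xrightarrow{a}2$, $1\xrightarrow{b}2$, $2\xrightarrow{a}5$, $2\xrightarrow{b}3$, $3\xrightarrow{a}4$, $3\xrightarrow{b}5$, $4\xrightarrow{a}3$, $4\xrightarrow{b}1$, $5\xrightarrow{a,b}5$. $\epsilon$ denotes the empty word. $PIP_2$ (PROMISE-INNER-PRODUCT) is the partial function on $\{0,1\}^n\times\{0,1\}^n$ defined by $PIP_2(x,y)=\sum_{i=1}^n x_iy_i \bmod 2$ on the domain $D$ consisting of all $(x,y)$ with $\sum_i x_iy_i$ odd, together with all $(x,y)$ with $\sum_i x_iy_i$ even such that for every $i$, writing $p_i=\sum_{j<i}x_jy_j \bmod 2$: if $x_i=0,y_i=1$ then $p_i=0$, and if $x_i=1,y_i=0$ then $p_i=1$. -}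

module Defs where

open import Data.Bool using (Bool; true; false; _∧_; _xor_)
open import Data.Nat using (ℕ; suc)
open import Data.Fin using (Fin; zero; suc)
open import Data.Vec using (Vec; []; _∷_)
open import Data.List using (List; []; _∷_; _++_)
open import Data.Maybe using (Maybe; just; nothing)
open import Data.Product using (_×_)
open import Data.Sum using (_⊎_)
open import Data.Unit using (⊤)
open import Relation.Binary.PropositionalEquality using (_≡_)

data Letter : Set where
  a b : Letter

-- A symbol from {a, b, ε}: `just ℓ` is a letter, `nothing` is the empty word ε.
Symbol : Set
Symbol = Maybe Letter

symWord : Symbol → List Letter
symWord (just ℓ) = ℓ ∷ []
symWord nothing  = []

data State : Set where
  q1 q2 q3 q4 q5 : State

δ : State → Letter → State
δ q1 a = q2
δ q1 b = q2
δ q2 a = q5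
δ q2 b = q3
δ q3 a = q4
δ q3 b = q5
δ q4 a = q3
δ q4 b = q1
δ q5 _ = q5

run : State → List Letter → State
run q []       = q
run q (ℓ ∷ w)  = run (δ q ℓ) w

L₅ : List Letter → Set
L₅ w = run q1 w ≡ q5

ip : ∀ {n} → Vec Bool n → Vec Bool n → Bool
ip []       []       = false
ip (x ∷ xs) (y ∷ ys) = (x ∧ y) xor ip xs ys

-- Local condition at a position i, given p = p_i = Σ_{j<i} x_j y_j mod 2
localCond : Bool → Bool → Bool → Set
localCond p false true  = p ≡ false
localCond p true  false = p ≡ true
localCond p _     _     = ⊤

PrefixCond : ∀ {n} → Bool → Vec Bool n → Vec Bool n → Set
PrefixCond p []       []       = ⊤
PrefixCond p (x ∷ xs) (y ∷ ys) = localCond p x y × PrefixCond (p xor (x ∧ y)) xs ys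

InD : ∀ {n} → Vec Bool n → Vec Bool n → Set
InD x y = (ip x y ≡ true) ⊎ ((ip x y ≡ false) × PrefixCond false x y)

PIP₂ : ∀ {n} → Vec Bool n → Vec Bool n → Bool
PIP₂ = ip

-- The word α₁(x) β₂(y) α₃(x) β₄(y) ⋯ α_{2t-1}(x) β_{2t}(y);
-- α i is α_{2i+1}, β i is β_{2i+2} (i : Fin t).
rectWord : ∀ {n} (t : ℕ) → (Fin t → Vec Bool n → Symbol) → (Fin t → Vec Bool n → Symbol)
         → Vec Bool n → Vec Bool n → List Letter
rectWord ℕ.zero    α β x y = []
rectWord (suc t)   α β x y =
  symWord (α zero x) ++ symWord (β zero y) ++ rectWord t (λ i → α (suc i)) (λ i → β (suc i)) x y

-- States 1 and 3 record the parity 0 and 1 of the inner product of the prefix read so far,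
-- and 5 is an accepting sink.  Coordinate i contributes a gadget word depending on (x_i, y_i):
-- from a parity state it either moves to the state of the updated parity, or, exactly when the
-- local promise condition fails, it falls into the sink.  A final letter b accepts from 3 and 5
-- and rejects from 1.  On the promise domain a violation only happens for odd inputs, so the
-- word is accepted iff the inner product is odd.  Each gadget is three rectangular columns.
module Submission where

open import Defs
open import Data.Bool using (Bool; true; false; _∧_; _xor_)
open import Data.Bool.Properties using (xor-assoc)
open import Data.Nat using (ℕ; suc; zero; _*_; _≤_; _+_; s≤s; z≤n)
open import Data.Nat.Properties using (+-monoʳ-≤; *-suc; ≤-trans; ≤-reflexive)
open import Data.Fin using (Fin; zero; suc)
open import Data.Vec using (Vec; []; _∷_; head; tail)
open import Data.List using (List; []; _∷_; _++_)
open import Data.List.Properties using (++-assoc)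
open import Data.Maybe using (just; nothing)
open import Data.Product using (Σ; _×_; _,_)
open import Data.Sum using (_⊎_; inj₁; inj₂)
open import Data.Empty using (⊥-elim)
open import Function using (_∘_)
open import Function.Bundles using (_⇔_; mk⇔)
open import Relation.Nullary using (¬_)
open import Relation.Binary.PropositionalEquality
  using (_≡_; _≢_; refl; sym; trans; cong; module ≡-Reasoning)

open ≡-Reasoning

run-++ : ∀ q u v → run q (u ++ v) ≡ run (run q u) v
run-++ q []      v = refl
run-++ q (ℓ ∷ u) v = run-++ (δ q ℓ) u v

run-q5 : ∀ w → run q5 w ≡ q5
run-q5 []      = refl
run-q5 (_ ∷ w) = run-q5 w

parityState : Bool → State
parityState false = q1
parityState true  = q3

gadget : Bool → Bool → List Letter
gadget false false = a ∷ b ∷ a ∷ b ∷ []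
gadget false true  = b ∷ b ∷ a ∷ b ∷ []
gadget true  false = a ∷ a ∷ a ∷ b ∷ a ∷ b ∷ []
gadget true  true  = a ∷ b ∷ a ∷ b ∷ a ∷ b ∷ []

gadget-step : ∀ p x y → localCond p x y →
              run (parityState p) (gadget x y) ≡ parityState (p xor (x ∧ y))
gadget-step false false false _ = refl
gadget-step false false true  _ = refl
gadget-step false true  false ()
gadget-step false true  true  _ = refl
gadget-step true  false false _ = refl
gadget-step true  false true  ()
gadget-step true  true  false _ = refl
gadget-step true  true  true  _ = refl

gadget-step-or-q5 : ∀ p x y → run (parityState p) (gadget x y) ≡ q5
                              ⊎ run (parityState p) (gadget x y) ≡ parityState (p xor (x ∧ y))
gadget-step-or-q5 false true  false = inj₁ refl
gadget-step-or-q5 true  false true  = inj₁ refl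
gadget-step-or-q5 false false false = inj₂ refl
gadget-step-or-q5 false false true  = inj₂ refl
gadget-step-or-q5 false true  true  = inj₂ refl
gadget-step-or-q5 true  false false = inj₂ refl
gadget-step-or-q5 true  true  false = inj₂ refl
gadget-step-or-q5 true  true  true  = inj₂ refl

encode : ∀ {n} → Vec Bool n → Vec Bool n → List Letter
encode []       []       = []
encode (x ∷ xs) (y ∷ ys) = gadget x y ++ encode xs ys

run-encode : ∀ {n} p (xs ys : Vec Bool n) → PrefixCond p xs ys →
             run (parityState p) (encode xs ys) ≡ parityState (p xor ip xs ys)
run-encode false [] [] _ = refl
run-encode true  [] [] _ = refl
run-encode p (x ∷ xs) (y ∷ ys) (c , cs) = begin
  run (parityState p) (gadget x y ++ encode xs ys)
    ≡⟨ run-++ (parityState p) (gadget x y) (encode xs ys) ⟩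
  run (run (parityState p) (gadget x y)) (encode xs ys)
    ≡⟨ cong (λ q → run q (encode xs ys)) (gadget-step p x y c) ⟩
  run (parityState (p xor (x ∧ y))) (encode xs ys)
    ≡⟨ run-encode (p xor (x ∧ y)) xs ys cs ⟩
  parityState ((p xor (x ∧ y)) xor ip xs ys)
    ≡⟨ cong parityState (xor-assoc p (x ∧ y) (ip xs ys)) ⟩
  parityState (p xor ip (x ∷ xs) (y ∷ ys)) ∎

run-encode-or-q5 : ∀ {n} p (xs ys : Vec Bool n) →
                   run (parityState p) (encode xs ys) ≡ q5
                   ⊎ run (parityState p) (encode xs ys) ≡ parityState (p xor ip xs ys)
run-encode-or-q5 false [] [] = inj₂ refl
run-encode-or-q5 true  [] [] = inj₂ refl
run-encode-or-q5 p (x ∷ xs) (y ∷ ys)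
  rewrite run-++ (parityState p) (gadget x y) (encode xs ys)
        | sym (xor-assoc p (x ∧ y) (ip xs ys))
  with run (parityState p) (gadget x y) | gadget-step-or-q5 p x y
... | _ | inj₁ refl = inj₁ (run-q5 (encode xs ys))
... | _ | inj₂ refl = run-encode-or-q5 (p xor (x ∧ y)) xs ys

reductionWord : ∀ {n} → Vec Bool n → Vec Bool n → List Letter
reductionWord x y = encode x y ++ b ∷ []

accepts-odd : ∀ {n} (x y : Vec Bool n) → ip x y ≡ true → L₅ (reductionWord x y)
accepts-odd x y odd with run-encode-or-q5 false x y
... | inj₁ sink = trans (run-++ q1 (encode x y) (b ∷ [])) (cong (λ q → δ q b) sink)
... | inj₂ step = begin
  run q1 (encode x y ++ b ∷ [])     ≡⟨ run-++ q1 (encode x y) (b ∷ []) ⟩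
  δ (run q1 (encode x y)) b         ≡⟨ cong (λ q → δ q b) step ⟩
  δ (parityState (ip x y)) b        ≡⟨ cong (λ p → δ (parityState p) b) odd ⟩
  q5                                ∎

rejects-even : ∀ {n} (x y : Vec Bool n) → PrefixCond false x y → ip x y ≡ false →
               ¬ L₅ (reductionWord x y)
rejects-even x y c even accepted with () ← begin
  q2                                ≡⟨ cong (λ p → δ (parityState p) b) (sym even) ⟩
  δ (parityState (ip x y)) b        ≡⟨ cong (λ q → δ q b) (sym (run-encode false x y c)) ⟩
  δ (run q1 (encode x y)) b         ≡⟨ sym (run-++ q1 (encode x y) (b ∷ [])) ⟩
  run q1 (encode x y ++ b ∷ [])     ≡⟨ accepted ⟩
  q5                                ∎

rectWord-∘ : ∀ {n m} t (α β : Fin t → Vec Bool m → Symbol) (f g : Vec Bool n → Vec Bool m) x y →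
             rectWord t (λ i → α i ∘ f) (λ i → β i ∘ g) x y ≡ rectWord t α β (f x) (g y)
rectWord-∘ zero    α β f g x y = refl
rectWord-∘ (suc t) α β f g x y =
  cong (λ w → symWord (α zero (f x)) ++ symWord (β zero (g y)) ++ w)
       (rectWord-∘ t (α ∘ suc) (β ∘ suc) f g x y)

rectLength : ℕ → ℕ
rectLength zero    = 1
rectLength (suc n) = 3 + rectLength n

rectLength≤ : ∀ n → rectLength n ≤ 3 * suc n
rectLength≤ zero    = s≤s z≤n
rectLength≤ (suc n) =
  ≤-trans (+-monoʳ-≤ 3 (rectLength≤ n)) (≤-reflexive (sym (*-suc 3 (suc n))))

xSymbol : Bool → Symbol
xSymbol true  = just a
xSymbol false = nothing

ySymbol : Bool → Symbol
ySymbol true  = just b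
ySymbol false = just a

reductionα : (n : ℕ) → Fin (rectLength n) → Vec Bool n → Symbol
reductionα zero    zero                _ = just b
reductionα (suc n) zero                v = xSymbol (head v)
reductionα (suc n) (suc zero)          v = xSymbol (head v)
reductionα (suc n) (suc (suc zero))    _ = just a
reductionα (suc n) (suc (suc (suc i))) v = reductionα n i (tail v)

reductionβ : (n : ℕ) → Fin (rectLength n) → Vec Bool n → Symbol
reductionβ zero    zero                _ = nothing
reductionβ (suc n) zero                v = ySymbol (head v)
reductionβ (suc n) (suc zero)          _ = just b
reductionβ (suc n) (suc (suc zero))    _ = just b
reductionβ (suc n) (suc (suc (suc i))) v = reductionβ n i (tail v)

gadget-columns : ∀ x y w →
  symWord (xSymbol x) ++ symWord (ySymbol y) ++ symWord (xSymbol x) ++ b ∷ a ∷ b ∷ w ≡ gadget x y ++ w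
gadget-columns false false w = refl
gadget-columns false true  w = refl
gadget-columns true  false w = refl
gadget-columns true  true  w = refl

rectWord-reduction : ∀ n (x y : Vec Bool n) →
                     rectWord (rectLength n) (reductionα n) (reductionβ n) x y ≡ reductionWord x y
rectWord-reduction zero    []       []       = refl
rectWord-reduction (suc n) (x ∷ xs) (y ∷ ys) = begin
  rectWord (rectLength (suc n)) (reductionα (suc n)) (reductionβ (suc n)) (x ∷ xs) (y ∷ ys)
    ≡⟨ gadget-columns x y _ ⟩
  gadget x y ++ rectWord (rectLength n) (λ i → reductionα n i ∘ tail) (λ i → reductionβ n i ∘ tail)
                         (x ∷ xs) (y ∷ ys)
    ≡⟨ cong (gadget x y ++_) (rectWord-∘ (rectLength n) (reductionα n) (reductionβ n) tail tail
                                          (x ∷ xs) (y ∷ ys)) ⟩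
  gadget x y ++ rectWord (rectLength n) (reductionα n) (reductionβ n) xs ys
    ≡⟨ cong (gadget x y ++_) (rectWord-reduction n xs ys) ⟩
  gadget x y ++ (encode xs ys ++ b ∷ [])
    ≡⟨ sym (++-assoc (gadget x y) (encode xs ys) (b ∷ [])) ⟩
  reductionWord (x ∷ xs) (y ∷ ys) ∎

reduction-correct : ∀ n (x y : Vec Bool n) → InD x y →
                    (PIP₂ x y ≡ true) ⇔ L₅ (rectWord (rectLength n) (reductionα n) (reductionβ n) x y)
reduction-correct n x y dom rewrite rectWord-reduction n x y with dom
... | inj₁ odd           = mk⇔ (λ _ → accepts-odd x y odd) (λ _ → odd)
... | inj₂ (even , cond) = mk⇔ (λ odd → ⊥-elim (true≢false (trans (sym odd) even)))
                               (λ accepted → ⊥-elim (rejects-even x y cond even accepted))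
  where
  true≢false : true ≢ false
  true≢false ()

propositionA3 : Σ ℕ λ c → (n : ℕ) → Σ ℕ λ t → (t ≤ c * suc n) × Σ (Fin t → Vec Bool n → Symbol) λ α → Σ (Fin t → Vec Bool n → Symbol) λ β → (x y : Vec Bool n) → InD x y → ((PIP₂ x y ≡ true) ⇔ L₅ (rectWord t α β x y))
propositionA3 = 3 , λ n → rectLength n , rectLength≤ n , reductionα n , reductionβ n , reduction-correct n
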